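{- Let $\lambda=(\lambda_1,\dots,\lambda_k)$ be a composition of $n$. The poset $C_\lambda$ (with the restriction of the Bruhat-Chevalley order of $S_n$) is unimodal and rank-symmetric, and moreover $$\sum_{\pi\in C_\lambda}q^{inv(\pi)}=[i_1]_q[i_2]_q\cdots[i_m]_q$$ for a certain sequence of integers $2\le i_1<i_2<\cdots<i_m\le n-1$.
   Context: $S_n$ is the symmetric group on $[n]$. The standard cyclic form of $\pi\in S_n$ is its expression as a product of disjoint cycles, with cycles of length one NOT omitted, each cycle beginning with its smallest entry, and cycles ordered by increasing first entries; the composition type of $\pi$ is the sequence of cycle lengths in this order. $\Omega:S_n\to S_n$ sends $\pi$ to the permutation whose one-line notation is the word obtained by deleting the parentheses from the standard cyclic form of $\pi$. For $\lambda\vDash n$, $C_\lambda:=\Omega(A_\lambda)$ where $A_\lambda$ is the set of permutations of composition type $\lambda$. $inv(x)=|\{(i,j):i<j,\ x(i)>x(j)\}|$, and the Bruhat-Chevalley order on $S_n$ is the transitive closure of $x<y$ where $y$ is obtained from $x$ by swapping two entries $a_i<a_j$ at positions $i<j$ with $inv(y)=inv(x)+1$; $C_\lambda$ is graded with rank function $inv$. $[r]_q=1+q+\cdots+q^{r-1}$. If $r_i$ is the number of elements of rank $i$ and $M$ is the rank of the maximum, rank-symmetric means $r_i=r_{M-i}$ for all $i$, and unimodal means $r_0\le\cdots\le r_{\lfloor M/2\rfloor}\ge\cdots\ge r_M$. -}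

module Defs where

open import Data.Nat using (ℕ; zero; suc; _+_; _*_; _∸_; _≤_; _<_; _⊔_; _<?_; _≟_; ⌊_/2⌋)
open import Data.List using (List; []; _∷_; _++_; [_]; map; concat; length; filter; foldr; upTo; replicate)
open import Data.Nat.ListAction using (sum)
open import Data.List.Relation.Unary.All using (All)
open import Data.List.Relation.Unary.Linked using (Linked)
open import Data.List.Relation.Binary.Permutation.Propositional using (_↭_)
open import Data.Product using (Σ; ∃; _×_; _,_; proj₁; proj₂)
open import Data.Unit using (⊤)
open import Relation.Binary.PropositionalEquality using (_≡_)

-- Permutations of [n] = {1,…,n} in one-line notation (lists of ℕ).

[1‥_] : ℕ → List ℕ
[1‥ n ] = map suc (upTo n)

IsPerm : ℕ → List ℕ → Set
IsPerm n w = w ↭ [1‥ n ]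

-- value of the permutation (one-line word) w at a ∈ [n]  (1-based)
_⟨_⟩ : List ℕ → ℕ → ℕ
[] ⟨ a ⟩ = 0
(x ∷ w) ⟨ zero ⟩ = 0
(x ∷ w) ⟨ suc zero ⟩ = x
(x ∷ w) ⟨ suc (suc a) ⟩ = w ⟨ suc a ⟩

Cycle : Set
Cycle = ℕ × List ℕ

cycleList : Cycle → List ℕ
cycleList (a , as) = a ∷ as

Chain : List ℕ → ℕ → List ℕ → Set
Chain π x [] = ⊤
Chain π x (y ∷ ys) = (π ⟨ x ⟩ ≡ y) × Chain π y ys

IsStdCycleOf : List ℕ → Cycle → Set
IsStdCycleOf π (a , as) = All (a ≤_) as × Chain π a (as ++ [ a ])

-- cs is the standard cyclic form of π ∈ S_n (fixed points included):
-- the cycles are disjoint and cover [n], each is a cycle of π beginning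
-- with its smallest entry, and first entries increase.
IsStdCyclicForm : ℕ → List ℕ → List Cycle → Set
IsStdCyclicForm n π cs =
  (concat (map cycleList cs) ↭ [1‥ n ]) ×
  All (IsStdCycleOf π) cs ×
  Linked _<_ (map proj₁ cs)

compType : List Cycle → List ℕ
compType cs = map (λ c → length (cycleList c)) cs

Ωword : List Cycle → List ℕ
Ωword cs = concat (map cycleList cs)

IsComposition : ℕ → List ℕ → Set
IsComposition n lam = All (1 ≤_) lam × sum lam ≡ n

InC : ℕ → List ℕ → List ℕ → Set
InC n lam w =
  Σ (List ℕ) λ π → IsPerm n π ×
    Σ (List Cycle) λ cs → IsStdCyclicForm n π cs × compType cs ≡ lam × Ωword cs ≡ w

inv : List ℕ → ℕ
inv [] = 0
inv (x ∷ w) = length (filter (λ y → y <? x) w) + inv w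

rankCount : List (List ℕ) → ℕ → ℕ
rankCount L i = length (filter (λ w → inv w ≟ i) L)

maxRank : List (List ℕ) → ℕ
maxRank L = foldr _⊔_ 0 (map inv L)

RankSymmetric : List (List ℕ) → Set
RankSymmetric L = ∀ i → i ≤ maxRank L → rankCount L i ≡ rankCount L (maxRank L ∸ i)

Unimodal : List (List ℕ) → Set
Unimodal L =
  (∀ i j → i ≤ j → j ≤ ⌊ maxRank L /2⌋ → rankCount L i ≤ rankCount L j) ×
  (∀ i j → ⌊ maxRank L /2⌋ ≤ i → i ≤ j → j ≤ maxRank L → rankCount L j ≤ rankCount L i)

-- Polynomials in q with ℕ coefficients as coefficient lists
-- (constant term first).

Poly : Set
Poly = List ℕ

_⊕_ : Poly → Poly → Poly
[] ⊕ q = q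
(a ∷ p) ⊕ [] = a ∷ p
(a ∷ p) ⊕ (b ∷ q) = (a + b) ∷ (p ⊕ q)

_⊛_ : Poly → Poly → Poly
[] ⊛ q = []
(a ∷ p) ⊛ q = map (a *_) q ⊕ (0 ∷ (p ⊛ q))

coeff : Poly → ℕ → ℕ
coeff [] i = 0
coeff (a ∷ p) zero = a
coeff (a ∷ p) (suc i) = coeff p i

qInt : ℕ → Poly
qInt r = replicate r 1

qIntProd : List ℕ → Poly
qIntProd is = foldr (λ i p → qInt i ⊛ p) (1 ∷ []) is

-- C_λ = Ω(A_λ) consists of the words cut into consecutive blocks of lengths λ₁, …, λ_k in
-- which every block begins with the least letter not used by the earlier blocks, the other
-- letters of the block being arbitrary.
-- Writing such a word from left to right, a block's first letter creates no inversions, while a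
-- free letter chosen among m remaining ones creates 0, 1, …, m - 1 inversions with the letters
-- after it.  So the rank generating function of C_λ is a product of q-integers [m]_q, and
-- multiplying by [r]_q preserves symmetry and unimodality of a coefficient sequence.

module Submission where

open import Defs
open import Function using (_∘_; id)
open import Data.Nat
open import Data.Nat.Properties
open import Data.Nat.Tactic.RingSolver using (solve-∀)
open import Data.Nat.ListAction using (sum)
open import Data.List using (List; []; _∷_; _++_; [_]; map; length; filter; applyUpTo; upTo; reverse)
open import Data.List.Properties
  using ( filter-accept; filter-reject; filter-none; ∷-injectiveʳ; map-++; ++-assoc; map-applyUpTo; map-∘
        ; unfold-reverse; length-map; length-upTo)
open import Data.List.Relation.Unary.All as All using (All; []; _∷_)
import Data.List.Relation.Unary.All.Properties as All
open import Data.List.Relation.Unary.AllPairs as AllPairs using (AllPairs; []; _∷_)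
import Data.List.Relation.Unary.AllPairs.Properties as AllPairs
open import Data.List.Relation.Unary.Linked as Linked using (Linked; []; [-]; _∷_)
open import Data.List.Relation.Unary.Linked.Properties using (AllPairs⇒Linked)
open import Data.List.Relation.Unary.Any using (here; there)
open import Data.List.Membership.Propositional using (_∈_)
open import Data.List.Membership.Propositional.Properties
  using (∈-map⁺; ∈-map⁻; ∈-++⁺ˡ; ∈-++⁺ʳ; ∈-++⁻; ∈-upTo⁻)
open import Data.List.Relation.Binary.Permutation.Propositional as ↭
  using (_↭_; prep; swap; ↭-refl; ↭-sym; ↭-trans; ↭-reflexive; ↭⇒↭ₛ)
open import Data.List.Relation.Binary.Permutation.Propositional.Properties
  using (∈-resp-↭; All-resp-↭; drop-∷; ↭-length; filter-↭; ↭-reverse; shift; ++⁺ˡ; map⁺)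
import Data.List.Relation.Binary.Permutation.Setoid.Properties as PermutationSetoid
open import Data.List.Relation.Unary.Unique.Propositional using (Unique)
import Data.List.Relation.Unary.Unique.Propositional.Properties as Unique
open import Data.Product using (Σ; ∃; ∃₂; _×_; _,_; proj₁; proj₂)
open import Data.Sum using (inj₁; inj₂)
open import Data.Unit using (tt)
open import Data.Empty using (⊥-elim)
open import Function.Bundles using (_⇔_; mk⇔)
open import Relation.Binary.PropositionalEquality
  using (_≡_; _≢_; _≗_; refl; sym; trans; cong; cong₂; subst; subst₂; setoid; module ≡-Reasoning)
open import Relation.Nullary using (¬_; yes; no)

-- Polynomials in q are handled through their coefficient sequences ℕ → ℕ.

qMul : (ℕ → ℕ) → ℕ → ℕ
qMul f zero = 0
qMul f (suc k) = f k

qPowMul : ℕ → (ℕ → ℕ) → ℕ → ℕ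
qPowMul zero f = f
qPowMul (suc r) f = qMul (qPowMul r f)

qIntMul : ℕ → (ℕ → ℕ) → ℕ → ℕ
qIntMul zero f k = 0
qIntMul (suc r) f k = f k + qMul (qIntMul r f) k

qIntProdMul : List ℕ → (ℕ → ℕ) → ℕ → ℕ
qIntProdMul [] f = f
qIntProdMul (i ∷ is) f = qIntMul i (qIntProdMul is f)

δ₀ : ℕ → ℕ
δ₀ zero = 1
δ₀ (suc _) = 0

qMul-cong : ∀ {f g} → f ≗ g → qMul f ≗ qMul g
qMul-cong e zero = refl
qMul-cong e (suc k) = e k

qPowMul-cong : ∀ r {f g} → f ≗ g → qPowMul r f ≗ qPowMul r g
qPowMul-cong zero e = e
qPowMul-cong (suc r) e = qMul-cong (qPowMul-cong r e)

qIntMul-cong : ∀ r {f g} → f ≗ g → qIntMul r f ≗ qIntMul r g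
qIntMul-cong zero e k = refl
qIntMul-cong (suc r) e k = cong₂ _+_ (e k) (qMul-cong (qIntMul-cong r e) k)

qMul-+ : ∀ f g k → qMul (λ x → f x + g x) k ≡ qMul f k + qMul g k
qMul-+ f g zero = refl
qMul-+ f g (suc k) = refl

qPowMul-hit : ∀ r f m → qPowMul r f (r + m) ≡ f m
qPowMul-hit zero f m = refl
qPowMul-hit (suc r) f m = qPowMul-hit r f m

qPowMul-below : ∀ r f {j} → j < r → qPowMul r f j ≡ 0
qPowMul-below (suc r) f {zero} _ = refl
qPowMul-below (suc r) f {suc j} (s≤s j<r) = qPowMul-below r f j<r

qIntMul-+ : ∀ r f g k → qIntMul r (λ x → f x + g x) k ≡ qIntMul r f k + qIntMul r g k
qIntMul-+ zero f g k = refl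
qIntMul-+ (suc r) f g k = begin
  (f k + g k) + qMul (qIntMul r (λ x → f x + g x)) k
    ≡⟨ cong ((f k + g k) +_) (qMul-cong (qIntMul-+ r f g) k) ⟩
  (f k + g k) + qMul (λ x → qIntMul r f x + qIntMul r g x) k
    ≡⟨ cong ((f k + g k) +_) (qMul-+ (qIntMul r f) (qIntMul r g) k) ⟩
  (f k + g k) + (qMul (qIntMul r f) k + qMul (qIntMul r g) k)
    ≡⟨ interchange (f k) (g k) _ _ ⟩
  (f k + qMul (qIntMul r f) k) + (g k + qMul (qIntMul r g) k) ∎
  where
  open ≡-Reasoning
  interchange : ∀ a b c d → (a + b) + (c + d) ≡ (a + c) + (b + d)
  interchange = solve-∀

qIntMul-qMul : ∀ r f k → qIntMul r (qMul f) k ≡ qMul (qIntMul r f) k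
qIntMul-qMul zero f zero = refl
qIntMul-qMul zero f (suc k) = refl
qIntMul-qMul (suc r) f zero = refl
qIntMul-qMul (suc r) f (suc k) = cong (f k +_) (qIntMul-qMul r f k)

qIntMul-comm : ∀ r s f k → qIntMul r (qIntMul s f) k ≡ qIntMul s (qIntMul r f) k
qIntMul-comm zero s f k = sym (qIntMul-zero s k)
  where
  qIntMul-zero : ∀ s k → qIntMul s (qIntMul zero f) k ≡ 0
  qIntMul-zero zero k = refl
  qIntMul-zero (suc s) zero = refl
  qIntMul-zero (suc s) (suc k) = qIntMul-zero s k
qIntMul-comm (suc r) s f k = begin
  qIntMul s f k + qMul (qIntMul r (qIntMul s f)) k
    ≡⟨ cong (qIntMul s f k +_) (qMul-cong (qIntMul-comm r s f) k) ⟩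
  qIntMul s f k + qMul (qIntMul s (qIntMul r f)) k
    ≡⟨ cong (qIntMul s f k +_) (qIntMul-qMul s (qIntMul r f) k) ⟨
  qIntMul s f k + qIntMul s (qMul (qIntMul r f)) k
    ≡⟨ qIntMul-+ s f (qMul (qIntMul r f)) k ⟨
  qIntMul s (qIntMul (suc r) f) k ∎
  where open ≡-Reasoning

qIntProdMul-↭ : ∀ {is js} → is ↭ js → ∀ f → qIntProdMul is f ≗ qIntProdMul js f
qIntProdMul-↭ ↭.refl f k = refl
qIntProdMul-↭ (prep i p) f = qIntMul-cong i (qIntProdMul-↭ p f)
qIntProdMul-↭ {is = i ∷ j ∷ _} {js = _ ∷ _ ∷ ks} (swap i j p) f k = trans
  (qIntMul-cong i (qIntMul-cong j (qIntProdMul-↭ p f)) k)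
  (qIntMul-comm i j (qIntProdMul ks f) k)
qIntProdMul-↭ (↭.trans p q) f k = trans (qIntProdMul-↭ p f k) (qIntProdMul-↭ q f k)

qIntMul-1 : ∀ f → qIntMul 1 f ≗ f
qIntMul-1 f zero = +-identityʳ _
qIntMul-1 f (suc k) = +-identityʳ _

qIntProdMul-filter : ∀ is → All (1 ≤_) is → ∀ f → qIntProdMul (filter (2 ≤?_) is) f ≗ qIntProdMul is f
qIntProdMul-filter [] [] f k = refl
qIntProdMul-filter (1 ∷ is) (_ ∷ ps) f k =
  trans (qIntProdMul-filter is ps f k) (sym (qIntMul-1 (qIntProdMul is f) k))
qIntProdMul-filter (suc (suc i) ∷ is) (_ ∷ ps) f = qIntMul-cong (suc (suc i)) (qIntProdMul-filter is ps f)

coeff-⊕ : ∀ p q k → coeff (p ⊕ q) k ≡ coeff p k + coeff q k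
coeff-⊕ [] q k = refl
coeff-⊕ (a ∷ p) [] zero = sym (+-identityʳ a)
coeff-⊕ (a ∷ p) [] (suc k) = sym (+-identityʳ _)
coeff-⊕ (a ∷ p) (b ∷ q) zero = refl
coeff-⊕ (a ∷ p) (b ∷ q) (suc k) = coeff-⊕ p q k

coeff-map-1* : ∀ p k → coeff (map (1 *_) p) k ≡ coeff p k
coeff-map-1* [] k = refl
coeff-map-1* (a ∷ p) zero = +-identityʳ a
coeff-map-1* (a ∷ p) (suc k) = coeff-map-1* p k

coeff-0∷ : ∀ p → coeff (0 ∷ p) ≗ qMul (coeff p)
coeff-0∷ p zero = refl
coeff-0∷ p (suc k) = refl

coeff-qInt-⊛ : ∀ r p → coeff (qInt r ⊛ p) ≗ qIntMul r (coeff p)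
coeff-qInt-⊛ zero p k = refl
coeff-qInt-⊛ (suc r) p k = begin
  coeff (map (1 *_) p ⊕ (0 ∷ (qInt r ⊛ p))) k
    ≡⟨ coeff-⊕ (map (1 *_) p) _ k ⟩
  coeff (map (1 *_) p) k + coeff (0 ∷ (qInt r ⊛ p)) k
    ≡⟨ cong₂ _+_ (coeff-map-1* p k) (coeff-0∷ _ k) ⟩
  coeff p k + qMul (coeff (qInt r ⊛ p)) k
    ≡⟨ cong (coeff p k +_) (qMul-cong (coeff-qInt-⊛ r p) k) ⟩
  qIntMul (suc r) (coeff p) k ∎
  where open ≡-Reasoning

coeff-qIntProd : ∀ is → coeff (qIntProd is) ≗ qIntProdMul is δ₀
coeff-qIntProd [] zero = refl
coeff-qIntProd [] (suc k) = refl
coeff-qIntProd (i ∷ is) k =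
  trans (coeff-qInt-⊛ i (qIntProd is) k) (qIntMul-cong i (coeff-qIntProd is) k)

qIntMul-suc : ∀ r f k → qIntMul (suc r) f k ≡ qIntMul r f k + qPowMul r f k
qIntMul-suc zero f zero = +-identityʳ _
qIntMul-suc zero f (suc k) = +-identityʳ _
qIntMul-suc (suc r) f k = begin
  f k + qMul (qIntMul (suc r) f) k
    ≡⟨ cong (f k +_) (qMul-cong (qIntMul-suc r f) k) ⟩
  f k + qMul (λ x → qIntMul r f x + qPowMul r f x) k
    ≡⟨ cong (f k +_) (qMul-+ (qIntMul r f) (qPowMul r f) k) ⟩
  f k + (qMul (qIntMul r f) k + qPowMul (suc r) f k)
    ≡⟨ +-assoc (f k) _ _ ⟨
  qIntMul (suc r) f k + qPowMul (suc r) f k ∎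
  where open ≡-Reasoning

qIntMul-vanish : ∀ {D f} → (∀ i → D < i → f i ≡ 0) → ∀ r i → D + r ≤ i → qIntMul r f i ≡ 0
qIntMul-vanish f>D zero i _ = refl
qIntMul-vanish {D} f>D (suc r) zero le rewrite +-suc D r with le
... | ()
qIntMul-vanish {D} f>D (suc r) (suc i) le rewrite +-suc D r =
  cong₂ _+_ (f>D (suc i) (s≤s (≤-trans (m≤m+n D r) (≤-pred le))))
            (qIntMul-vanish f>D r i (≤-pred le))

record SymmetricUnimodal (D : ℕ) (f : ℕ → ℕ) : Set where
  field
    vanish : ∀ i → D < i → f i ≡ 0
    symmetric : ∀ i j → i + j ≡ D → f i ≡ f j
    increasing : ∀ k → suc k + suc k ≤ D → f k ≤ f (suc k)
open SymmetricUnimodal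

symmetricUnimodal-δ₀ : SymmetricUnimodal 0 δ₀
symmetricUnimodal-δ₀ = record { vanish = δ₀-vanish ; symmetric = δ₀-symmetric ; increasing = λ k () }
  where
  δ₀-vanish : ∀ i → 0 < i → δ₀ i ≡ 0
  δ₀-vanish (suc i) _ = refl
  δ₀-symmetric : ∀ i j → i + j ≡ 0 → δ₀ i ≡ δ₀ j
  δ₀-symmetric zero zero _ = refl

module _ {D f} (su : SymmetricUnimodal D f) where

  monotone : ∀ {a b} → a ≤ b → b + b ≤ D → f a ≤ f b
  monotone {a} {zero} z≤n _ = ≤-refl
  monotone {a} {suc b} a≤1+b 2b≤D with m≤n⇒m<n∨m≡n a≤1+b
  ... | inj₂ refl = ≤-refl
  ... | inj₁ (s≤s a≤b) =
    ≤-trans (monotone a≤b (≤-trans (+-mono-≤ (n≤1+n b) (n≤1+n b)) 2b≤D)) (increasing su b 2b≤D)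

  -- Reflect b to D - b when b lies beyond the centre.
  monotone-centred : ∀ {a b} → a ≤ b → a + b ≤ D → f a ≤ f b
  monotone-centred {a} {b} a≤b a+b≤D with b + b ≤? D
  ... | yes 2b≤D = monotone a≤b 2b≤D
  ... | no 2b≰D with m≤n⇒∃[o]m+o≡n (≤-trans (m≤n+m b a) a+b≤D)
  ... | c , b+c≡D = subst (f a ≤_) (symmetric su c b (trans (+-comm c b) b+c≡D)) (monotone a≤c 2c≤D)
    where
    a≤c : a ≤ c
    a≤c = +-cancelʳ-≤ b a c (subst (a + b ≤_) (sym (trans (+-comm c b) b+c≡D)) a+b≤D)
    c<b : c < b
    c<b = +-cancelˡ-< b c b (subst (_< b + b) (sym b+c≡D) (≰⇒> 2b≰D))
    2c≤D : c + c ≤ D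
    2c≤D = subst (c + c ≤_) b+c≡D (+-monoˡ-≤ c (<⇒≤ c<b))

  qIntMul-symmetric : ∀ r i j → i + j ≡ D + r → qIntMul (suc r) f i ≡ qIntMul (suc r) f j
  qIntMul-symmetric zero i j i+j≡D+0 = begin
    qIntMul 1 f i ≡⟨ qIntMul-1 f i ⟩
    f i           ≡⟨ symmetric su i j (trans i+j≡D+0 (+-identityʳ D)) ⟩
    f j           ≡⟨ qIntMul-1 f j ⟨
    qIntMul 1 f j ∎
    where open ≡-Reasoning
  qIntMul-symmetric (suc r) i j i+j≡D+R = begin
    f i + qMul (qIntMul R f) i     ≡⟨ cong₂ _+_ outer inner ⟩
    qPowMul R f j + qIntMul R f j  ≡⟨ +-comm (qPowMul R f j) (qIntMul R f j) ⟩
    qIntMul R f j + qPowMul R f j  ≡⟨ qIntMul-suc R f j ⟨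
    qIntMul (suc R) f j ∎
    where
    open ≡-Reasoning
    R : ℕ
    R = suc r
    outer : f i ≡ qPowMul R f j
    outer with R ≤? j
    ... | yes R≤j with m≤n⇒∃[o]m+o≡n R≤j
    ...   | m , refl = trans (symmetric su i m i+m≡D) (sym (qPowMul-hit R f m))
      where
      i+m≡D : i + m ≡ D
      i+m≡D = +-cancelʳ-≡ R (i + m) D
        (trans (trans (+-assoc i m R) (cong (i +_) (+-comm m R))) i+j≡D+R)
    outer | no R≰j = trans (vanish su i D<i) (sym (qPowMul-below R f (≰⇒> R≰j)))
      where
      D<i : D < i
      D<i with D <? i
      ... | yes D<i = D<i
      ... | no D≮i = ⊥-elim (<-irrefl i+j≡D+R (+-mono-≤-< (≮⇒≥ D≮i) (≰⇒> R≰j)))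
    inner : qMul (qIntMul R f) i ≡ qIntMul R f j
    inner = qMul-qIntMul i i+j≡D+R
      where
      qMul-qIntMul : ∀ i → i + j ≡ D + R → qMul (qIntMul R f) i ≡ qIntMul R f j
      qMul-qIntMul zero j≡D+R = sym (qIntMul-vanish (vanish su) R j (≤-reflexive (sym j≡D+R)))
      qMul-qIntMul (suc i) e = qIntMul-symmetric r i j (suc-injective (trans e (+-suc D r)))

  -- [r+1]_q·f rises from k to k+1 by f(k+1) - f(k-r), which is nonnegative left of the centre.
  qIntMul-increasing : ∀ r k → suc k + suc k ≤ D + r → qIntMul (suc r) f k ≤ qIntMul (suc r) f (suc k)
  qIntMul-increasing r k 2k+2≤D+r = begin
    qIntMul (suc r) f k           ≡⟨ qIntMul-suc r f k ⟩
    qIntMul r f k + qPowMul r f k ≤⟨ +-monoʳ-≤ (qIntMul r f k) lagging≤leading ⟩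
    qIntMul r f k + f (suc k)     ≡⟨ +-comm (qIntMul r f k) (f (suc k)) ⟩
    qIntMul (suc r) f (suc k)     ∎
    where
    open ≤-Reasoning
    lagging≤leading : qPowMul r f k ≤ f (suc k)
    lagging≤leading with r ≤? k
    ... | no r≰k = subst (_≤ f (suc k)) (sym (qPowMul-below r f (≰⇒> r≰k))) z≤n
    ... | yes r≤k with m≤n⇒∃[o]m+o≡n r≤k
    ...   | m , refl = subst (_≤ f (suc (r + m))) (sym (qPowMul-hit r f m))
                        (monotone-centred (m≤n⇒m≤1+n (m≤n+m m r)) sum≤D)
      where
      rearrange : ∀ r m → suc (r + m) + suc (r + m) ≡ suc (m + suc (r + m)) + r
      rearrange = solve-∀
      sum≤D : m + suc (r + m) ≤ D
      sum≤D = ≤-trans (n≤1+n _)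
        (+-cancelʳ-≤ r (suc (m + suc (r + m))) D (subst (_≤ D + r) (rearrange r m) 2k+2≤D+r))

symmetricUnimodal-qIntMul : ∀ {D f} → SymmetricUnimodal D f → ∀ r → SymmetricUnimodal (D + r) (qIntMul (suc r) f)
symmetricUnimodal-qIntMul {D} su r = record
  { vanish = λ i D+r<i → qIntMul-vanish (vanish su) (suc r) i (subst (_≤ i) (sym (+-suc D r)) D+r<i)
  ; symmetric = qIntMul-symmetric su r
  ; increasing = qIntMul-increasing su r
  }

degree : List ℕ → ℕ
degree [] = 0
degree (i ∷ is) = degree is + (i ∸ 1)

symmetricUnimodal-qIntProdMul : ∀ is → All (1 ≤_) is → SymmetricUnimodal (degree is) (qIntProdMul is δ₀)
symmetricUnimodal-qIntProdMul [] [] = symmetricUnimodal-δ₀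
symmetricUnimodal-qIntProdMul (suc r ∷ is) (_ ∷ ps) =
  symmetricUnimodal-qIntMul (symmetricUnimodal-qIntProdMul is ps) r

qIntProdMul-δ₀-0 : ∀ is → All (1 ≤_) is → qIntProdMul is δ₀ 0 ≡ 1
qIntProdMul-δ₀-0 [] [] = refl
qIntProdMul-δ₀-0 (suc r ∷ is) (_ ∷ ps) = trans (+-identityʳ _) (qIntProdMul-δ₀-0 is ps)

rankCount-hit : ∀ w L {d} → inv w ≡ d → rankCount (w ∷ L) d ≡ suc (rankCount L d)
rankCount-hit w L {d} e = cong length (filter-accept (λ v → inv v ≟ d) {x = w} {xs = L} e)

rankCount-miss : ∀ w L {d} → inv w ≢ d → rankCount (w ∷ L) d ≡ rankCount L d
rankCount-miss w L {d} ne = cong length (filter-reject (λ v → inv v ≟ d) {x = w} {xs = L} ne)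

rankCount-∷ : ∀ w L d → rankCount L d ≤ rankCount (w ∷ L) d
rankCount-∷ w L d with inv w ≟ d
... | yes e = ≤-trans (n≤1+n _) (≤-reflexive (sym (rankCount-hit w L e)))
... | no ne = ≤-reflexive (sym (rankCount-miss w L ne))

maxRank-≤ : ∀ L D → (∀ d → D < d → rankCount L d ≡ 0) → maxRank L ≤ D
maxRank-≤ [] D _ = z≤n
maxRank-≤ (w ∷ L) D none = ⊔-lub inv-w≤D (maxRank-≤ L D noneL)
  where
  noneL : ∀ d → D < d → rankCount L d ≡ 0
  noneL d D<d = n≤0⇒n≡0 (subst (rankCount L d ≤_) (none d D<d) (rankCount-∷ w L d))
  inv-w≤D : inv w ≤ D
  inv-w≤D with inv w ≤? D
  ... | yes p = p
  ... | no p with trans (sym (rankCount-hit w L refl)) (none (inv w) (≰⇒> p))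
  ...   | ()

≤-maxRank : ∀ L d → 0 < rankCount L d → d ≤ maxRank L
≤-maxRank (w ∷ L) d pos with inv w ≟ d
... | yes refl = m≤m⊔n (inv w) (maxRank L)
... | no ne = ≤-trans (≤-maxRank L d (subst (0 <_) (rankCount-miss w L ne) pos)) (m≤n⊔m (inv w) (maxRank L))

module _ (L : List (List ℕ)) {D f} (su : SymmetricUnimodal D f) (f0 : f 0 ≡ 1) (counts : rankCount L ≗ f) where

  maxRank-symmetricUnimodal : maxRank L ≡ D
  maxRank-symmetricUnimodal = ≤-antisym
    (maxRank-≤ L D (λ d D<d → trans (counts d) (vanish su d D<d)))
    (≤-maxRank L D (subst (0 <_) (sym (trans (counts D) fD≡1)) (s≤s z≤n)))
    where
    fD≡1 : f D ≡ 1
    fD≡1 = trans (symmetric su D 0 (+-identityʳ D)) f0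

  rankSymmetric : RankSymmetric L
  rankSymmetric i i≤max rewrite maxRank-symmetricUnimodal =
    trans (counts i) (trans (symmetric su i (D ∸ i) (m+[n∸m]≡n i≤max)) (sym (counts (D ∸ i))))

  unimodal : Unimodal L
  unimodal = rising , falling
    where
    rising : ∀ i j → i ≤ j → j ≤ ⌊ maxRank L /2⌋ → rankCount L i ≤ rankCount L j
    rising i j i≤j j≤half rewrite maxRank-symmetricUnimodal | counts i | counts j =
      monotone su i≤j (subst (j + j ≤_) (⌊n/2⌋+⌈n/2⌉≡n D)
        (+-mono-≤ j≤half (≤-trans j≤half (⌊n/2⌋≤⌈n/2⌉ D))))
    -- Reflect i < j to D - i > D - j, whose sum is at most D.
    falling : ∀ i j → ⌊ maxRank L /2⌋ ≤ i → i ≤ j → j ≤ maxRank L → rankCount L j ≤ rankCount L i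
    falling i j half≤i i≤j j≤D rewrite maxRank-symmetricUnimodal | counts i | counts j
      with m≤n⇒m<n∨m≡n i≤j
    ... | inj₂ refl = ≤-refl
    ... | inj₁ i<j with m≤n⇒∃[o]m+o≡n j≤D | m≤n⇒∃[o]m+o≡n (≤-trans i≤j j≤D)
    ...   | a , j+a≡D | b , i+b≡D =
      subst₂ _≤_ (symmetric su a j (trans (+-comm a j) j+a≡D)) (symmetric su b i (trans (+-comm b i) i+b≡D))
        (monotone-centred su a≤b a+b≤D)
      where
      a≤b : a ≤ b
      a≤b = +-cancelˡ-≤ i a b (≤-trans (+-monoˡ-≤ a i≤j) (≤-reflexive (trans j+a≡D (sym i+b≡D))))
      ⌈D/2⌉≤1+⌊D/2⌋ : ∀ n → ⌈ n /2⌉ ≤ suc ⌊ n /2⌋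
      ⌈D/2⌉≤1+⌊D/2⌋ zero = z≤n
      ⌈D/2⌉≤1+⌊D/2⌋ (suc zero) = s≤s z≤n
      ⌈D/2⌉≤1+⌊D/2⌋ (suc (suc n)) = s≤s (⌈D/2⌉≤1+⌊D/2⌋ n)
      D≤i+j : D ≤ i + j
      D≤i+j = subst (_≤ i + j) (⌊n/2⌋+⌈n/2⌉≡n D)
        (+-mono-≤ half≤i (≤-trans (⌈D/2⌉≤1+⌊D/2⌋ D) (≤-trans (s≤s half≤i) i<j)))
      rearrange : ∀ a b i j → (a + b) + (i + j) ≡ (j + a) + (i + b)
      rearrange = solve-∀
      a+b≤D : a + b ≤ D
      a+b≤D = +-cancelʳ-≤ (i + j) (a + b) D
        (subst (_≤ D + (i + j)) (sym (trans (rearrange a b i j) (cong₂ _+_ j+a≡D i+b≡D))) (+-monoʳ-≤ D D≤i+j))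

Sorted : List ℕ → Set
Sorted = AllPairs _<_

StdCycles : List Cycle → Set
StdCycles cs = All (λ c → All (proj₁ c ≤_) (proj₂ c)) cs × Linked _<_ (map proj₁ cs)

consRest : ℕ → ℕ × List ℕ → ℕ × List ℕ
consRest y (x , R) = x , y ∷ R

select : List ℕ → List (ℕ × List ℕ)
select [] = []
select (y ∷ R) = (y , R) ∷ map (consRest y) (select R)

select-↭ : ∀ {R x R′} → (x , R′) ∈ select R → x ∷ R′ ↭ R
select-↭ {y ∷ R} (here refl) = ↭-refl
select-↭ {y ∷ R} (there m) with ∈-map⁻ (consRest y) m
... | (x , R″) , m′ , refl = ↭-trans (swap x y ↭-refl) (prep y (select-↭ m′))

select-∈ : ∀ {R x R′} → (x , R′) ∈ select R → x ∈ R
select-∈ m = ∈-resp-↭ (select-↭ m) (here refl)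

select-sorted : ∀ {R x R′} → Sorted R → (x , R′) ∈ select R → Sorted R′
select-sorted {y ∷ R} (_ ∷ s) (here refl) = s
select-sorted {y ∷ R} (y<R ∷ s) (there m) with ∈-map⁻ (consRest y) m
... | (x , R″) , m′ , refl = All.tail (All-resp-↭ (↭-sym (select-↭ m′)) y<R) ∷ select-sorted s m′

∈-select : ∀ {R x} → x ∈ R → ∃ λ R′ → (x , R′) ∈ select R
∈-select {y ∷ R} (here refl) = R , here refl
∈-select {y ∷ R} (there m) with ∈-select m
... | R′ , m′ = y ∷ R′ , there (∈-map⁺ (consRest y) m′)

map-proj₁-select : ∀ R → map proj₁ (select R) ≡ R
map-proj₁-select [] = refl
map-proj₁-select (y ∷ R) = cong (y ∷_) (trans (proj₁-consRest (select R)) (map-proj₁-select R))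
  where
  proj₁-consRest : ∀ S → map proj₁ (map (consRest y) S) ≡ map proj₁ S
  proj₁-consRest [] = refl
  proj₁-consRest (_ ∷ S) = cong (_ ∷_) (proj₁-consRest S)

-- cWords R lam is C_λ over the sorted alphabet R; cWordsTail R ℓ lam first places ℓ free
-- letters completing the current block.
mutual
  cWords : List ℕ → List ℕ → List (List ℕ)
  cWords [] [] = [] ∷ []
  cWords (a ∷ R) [] = []
  cWords [] (_ ∷ _) = []
  cWords (a ∷ R) (zero ∷ lam) = []
  cWords (a ∷ R) (suc ℓ ∷ lam) = map (a ∷_) (cWordsTail R ℓ lam)

  cWordsTail : List ℕ → ℕ → List ℕ → List (List ℕ)
  cWordsTail R zero lam = cWords R lam
  cWordsTail R (suc ℓ) lam = cWordsVia (select R) ℓ lam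

  cWordsVia : List (ℕ × List ℕ) → ℕ → List ℕ → List (List ℕ)
  cWordsVia [] ℓ lam = []
  cWordsVia ((x , R′) ∷ S) ℓ lam = map (x ∷_) (cWordsTail R′ ℓ lam) ++ cWordsVia S ℓ lam

record CyclesOf (R lam w : List ℕ) : Set where
  field
    cycles : List Cycle
    Ωword≡ : Ωword cycles ≡ w
    compType≡ : compType cycles ≡ lam
    Ωword↭ : Ωword cycles ↭ R
    std : StdCycles cycles

record CyclesAfter (R : List ℕ) (ℓ : ℕ) (lam w : List ℕ) : Set where
  field
    prefix : List ℕ
    cycles : List Cycle
    Ωword≡ : prefix ++ Ωword cycles ≡ w
    length-prefix : length prefix ≡ ℓ
    compType≡ : compType cycles ≡ lam
    Ωword↭ : prefix ++ Ωword cycles ↭ R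
    std : StdCycles cycles

linked-∷ : ∀ {a} cs → All (a <_) (Ωword cs) → Linked _<_ (map proj₁ cs) → Linked _<_ (a ∷ map proj₁ cs)
linked-∷ [] _ _ = [-]
linked-∷ ((b , _) ∷ _) (a<b ∷ _) l = a<b ∷ l

mutual
  cWords-sound : ∀ R lam {w} → Sorted R → w ∈ cWords R lam → CyclesOf R lam w
  cWords-sound [] [] _ (here refl) = record
    { cycles = [] ; Ωword≡ = refl ; compType≡ = refl ; Ωword↭ = ↭-refl ; std = [] , [] }
  cWords-sound (a ∷ R) (suc ℓ ∷ lam) (a<R ∷ s) m with ∈-map⁻ (a ∷_) m
  ... | v , v∈ , refl = record
    { cycles = (a , prefix) ∷ cycles
    ; Ωword≡ = cong (a ∷_) Ωword≡
    ; compType≡ = cong₂ _∷_ (cong suc length-prefix) compType≡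
    ; Ωword↭ = prep a Ωword↭
    ; std = All.map <⇒≤ (All.++⁻ˡ prefix a<rest) ∷ proj₁ std
          , linked-∷ cycles (All.++⁻ʳ prefix a<rest) (proj₂ std)
    }
    where
    open CyclesAfter (cWordsTail-sound R ℓ lam s v∈)
    a<rest : All (a <_) (prefix ++ Ωword cycles)
    a<rest = All-resp-↭ (↭-sym Ωword↭) a<R

  cWordsTail-sound : ∀ R ℓ lam {w} → Sorted R → w ∈ cWordsTail R ℓ lam → CyclesAfter R ℓ lam w
  cWordsTail-sound R zero lam s m = record
    { prefix = [] ; cycles = cycles ; Ωword≡ = Ωword≡ ; length-prefix = refl
    ; compType≡ = compType≡ ; Ωword↭ = Ωword↭ ; std = std }
    where open CyclesOf (cWords-sound R lam s m)
  cWordsTail-sound R (suc ℓ) lam s m =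
    cWordsVia-sound (select R) ℓ lam (λ x∈ → select-↭ x∈ , select-sorted s x∈) m

  cWordsVia-sound : ∀ S {R} ℓ lam {w} → (∀ {x R′} → (x , R′) ∈ S → (x ∷ R′ ↭ R) × Sorted R′) →
                    w ∈ cWordsVia S ℓ lam → CyclesAfter R (suc ℓ) lam w
  cWordsVia-sound ((x , R′) ∷ S) ℓ lam h m with ∈-++⁻ (map (x ∷_) (cWordsTail R′ ℓ lam)) m
  ... | inj₂ m′ = cWordsVia-sound S ℓ lam (λ x∈ → h (there x∈)) m′
  ... | inj₁ m′ with ∈-map⁻ (x ∷_) m′
  ...   | v , v∈ , refl = record
    { prefix = x ∷ prefix ; cycles = cycles ; Ωword≡ = cong (x ∷_) Ωword≡
    ; length-prefix = cong suc length-prefix ; compType≡ = compType≡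
    ; Ωword↭ = ↭-trans (prep x Ωword↭) (proj₁ (h (here refl))) ; std = std }
    where open CyclesAfter (cWordsTail-sound R′ ℓ lam (proj₂ (h (here refl))) v∈)

cWordsTail-↭ : ∀ R ℓ lam {w} → Sorted R → w ∈ cWordsTail R ℓ lam → w ↭ R
cWordsTail-↭ R ℓ lam s m = subst (_↭ R) Ωword≡ Ωword↭
  where open CyclesAfter (cWordsTail-sound R ℓ lam s m)

first≤Ωword : ∀ a as cs → All (a ≤_) as → StdCycles cs → Linked _<_ (a ∷ map proj₁ cs) →
              All (a ≤_) ((a ∷ as) ++ Ωword cs)
first≤Ωword a as [] a≤as _ _ = ≤-refl ∷ All.++⁺ a≤as []
first≤Ωword a as ((b , bs) ∷ cs) a≤as (b≤bs ∷ std , b<cs) (a<b ∷ _) =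
  ≤-refl ∷ All.++⁺ a≤as
    (All.map (≤-trans (<⇒≤ a<b)) (first≤Ωword b bs cs b≤bs (std , Linked.tail b<cs) b<cs))

∈-cWordsVia : ∀ {S x R′ v ℓ lam} → (x , R′) ∈ S → v ∈ cWordsTail R′ ℓ lam →
              x ∷ v ∈ cWordsVia S ℓ lam
∈-cWordsVia {(y , R″) ∷ S} (here refl) v∈ = ∈-++⁺ˡ (∈-map⁺ (_ ∷_) v∈)
∈-cWordsVia {(y , R″) ∷ S} (there x∈) v∈ = ∈-++⁺ʳ _ (∈-cWordsVia x∈ v∈)

mutual
  cWords-complete : ∀ R cs → Sorted R → StdCycles cs → Ωword cs ↭ R → Ωword cs ∈ cWords R (compType cs)
  cWords-complete [] [] _ _ _ = here refl
  cWords-complete (r ∷ R) [] _ _ p with ↭-length p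
  ... | ()
  cWords-complete [] ((a , as) ∷ cs) _ _ p with ↭-length p
  ... | ()
  cWords-complete (r ∷ R) ((a , as) ∷ cs) (r<R ∷ s) (a≤as ∷ std , a<cs) p with a≡r
    where
    a≤r : a ≤ r
    a≤r = All.lookup (first≤Ωword a as cs a≤as (std , Linked.tail a<cs) a<cs) (∈-resp-↭ (↭-sym p) (here refl))
    a≡r : a ≡ r
    a≡r with ∈-resp-↭ p (here refl)
    ... | here a≡r = a≡r
    ... | there a∈R = ⊥-elim (<⇒≱ (All.lookup r<R a∈R) a≤r)
  ... | refl = ∈-map⁺ (a ∷_) (cWordsTail-complete R as cs s (std , Linked.tail a<cs) (drop-∷ p))

  cWordsTail-complete : ∀ R bs cs → Sorted R → StdCycles cs → bs ++ Ωword cs ↭ R →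
                        bs ++ Ωword cs ∈ cWordsTail R (length bs) (compType cs)
  cWordsTail-complete R [] cs s std p = cWords-complete R cs s std p
  cWordsTail-complete R (b ∷ bs) cs s std p with ∈-select (∈-resp-↭ p (here refl))
  ... | R′ , b∈ = ∈-cWordsVia b∈ (cWordsTail-complete R′ bs cs (select-sorted s b∈) std
                    (drop-∷ (↭-trans p (↭-sym (select-↭ b∈)))))

cWordsVia-head : ∀ S ℓ lam {w} → w ∈ cWordsVia S ℓ lam → ∃₂ λ x v → w ≡ x ∷ v × x ∈ map proj₁ S
cWordsVia-head ((x , R′) ∷ S) ℓ lam m with ∈-++⁻ (map (x ∷_) (cWordsTail R′ ℓ lam)) m
... | inj₁ m′ with ∈-map⁻ (x ∷_) m′
...   | v , _ , refl = x , v , refl , here refl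
cWordsVia-head ((x , R′) ∷ S) ℓ lam m | inj₂ m′ with cWordsVia-head S ℓ lam m′
... | y , v , refl , y∈ = y , v , refl , there y∈

mutual
  cWords-unique : ∀ R lam → Sorted R → Unique (cWords R lam)
  cWords-unique [] [] _ = [] ∷ []
  cWords-unique (a ∷ R) [] _ = []
  cWords-unique [] (_ ∷ _) _ = []
  cWords-unique (a ∷ R) (zero ∷ lam) _ = []
  cWords-unique (a ∷ R) (suc ℓ ∷ lam) (_ ∷ s) = Unique.map⁺ ∷-injectiveʳ (cWordsTail-unique R ℓ lam s)

  cWordsTail-unique : ∀ R ℓ lam → Sorted R → Unique (cWordsTail R ℓ lam)
  cWordsTail-unique R zero lam s = cWords-unique R lam s
  cWordsTail-unique R (suc ℓ) lam s = cWordsVia-unique (select R) ℓ lam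
    (subst Unique (sym (map-proj₁-select R)) (AllPairs.map <⇒≢ s)) (select-sorted s)

  cWordsVia-unique : ∀ S ℓ lam → Unique (map proj₁ S) → (∀ {x R′} → (x , R′) ∈ S → Sorted R′) →
                     Unique (cWordsVia S ℓ lam)
  cWordsVia-unique [] ℓ lam _ _ = []
  cWordsVia-unique ((x , R′) ∷ S) ℓ lam (x∉S ∷ u) h =
    Unique.++⁺ (Unique.map⁺ ∷-injectiveʳ (cWordsTail-unique R′ ℓ lam (h (here refl))))
               (cWordsVia-unique S ℓ lam u (λ m → h (there m))) disjoint
    where
    disjoint : ∀ {w} → ¬ (w ∈ map (x ∷_) (cWordsTail R′ ℓ lam) × w ∈ cWordsVia S ℓ lam)
    disjoint (m , m′) with ∈-map⁻ (x ∷_) m | cWordsVia-head S ℓ lam m′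
    ... | _ , _ , refl | y , _ , refl , y∈ = All.lookup x∉S y∈ refl

rankCount-++ : ∀ xs ys d → rankCount (xs ++ ys) d ≡ rankCount xs d + rankCount ys d
rankCount-++ [] ys d = refl
rankCount-++ (w ∷ xs) ys d with inv w ≟ d
... | yes e = begin
  rankCount (w ∷ xs ++ ys) d            ≡⟨ rankCount-hit w (xs ++ ys) e ⟩
  suc (rankCount (xs ++ ys) d)          ≡⟨ cong suc (rankCount-++ xs ys d) ⟩
  suc (rankCount xs d + rankCount ys d) ≡⟨ cong (_+ rankCount ys d) (rankCount-hit w xs e) ⟨
  rankCount (w ∷ xs) d + rankCount ys d ∎
  where open ≡-Reasoning
... | no ne = begin
  rankCount (w ∷ xs ++ ys) d            ≡⟨ rankCount-miss w (xs ++ ys) ne ⟩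
  rankCount (xs ++ ys) d                ≡⟨ rankCount-++ xs ys d ⟩
  rankCount xs d + rankCount ys d       ≡⟨ cong (_+ rankCount ys d) (rankCount-miss w xs ne) ⟨
  rankCount (w ∷ xs) d + rankCount ys d ∎
  where open ≡-Reasoning

lessCount : ℕ → List ℕ → ℕ
lessCount x w = length (filter (_<? x) w)

lessCount-↭ : ∀ x {w R} → w ↭ R → lessCount x w ≡ lessCount x R
lessCount-↭ x p = ↭-length (filter-↭ (_<? x) p)

lessCount-none : ∀ x {R} → All (x <_) R → lessCount x R ≡ 0
lessCount-none x x<R = cong length (filter-none (_<? x) (All.map (λ x<y y<x → <-asym x<y y<x) x<R))

module _ (x s : ℕ) where

  private
    inv-∷ : ∀ w → lessCount x w ≡ s → inv (x ∷ w) ≡ s + inv w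
    inv-∷ w e = cong (_+ inv w) e

  rankCount-map-∷-hit : ∀ L → All (λ w → lessCount x w ≡ s) L → ∀ m →
                        rankCount (map (x ∷_) L) (s + m) ≡ rankCount L m
  rankCount-map-∷-hit [] [] m = refl
  rankCount-map-∷-hit (w ∷ L) (e ∷ es) m with inv w ≟ m
  ... | yes inv≡m = trans (rankCount-hit (x ∷ w) (map (x ∷_) L) (trans (inv-∷ w e) (cong (s +_) inv≡m)))
                      (trans (cong suc (rankCount-map-∷-hit L es m)) (sym (rankCount-hit w L inv≡m)))
  ... | no inv≢m = trans
                     (rankCount-miss (x ∷ w) (map (x ∷_) L) (inv≢m ∘ +-cancelˡ-≡ s _ _ ∘ trans (sym (inv-∷ w e))))
                     (trans (rankCount-map-∷-hit L es m) (sym (rankCount-miss w L inv≢m)))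

  rankCount-map-∷-below : ∀ L → All (λ w → lessCount x w ≡ s) L → ∀ {d} → d < s →
                          rankCount (map (x ∷_) L) d ≡ 0
  rankCount-map-∷-below [] [] d<s = refl
  rankCount-map-∷-below (w ∷ L) (e ∷ es) d<s = trans
    (rankCount-miss (x ∷ w) (map (x ∷_) L)
      (λ inv≡d → <⇒≱ d<s (≤-trans (m≤m+n s (inv w)) (≤-reflexive (trans (sym (inv-∷ w e)) inv≡d)))))
    (rankCount-map-∷-below L es d<s)

  rankCount-map-∷ : ∀ L → All (λ w → lessCount x w ≡ s) L →
                    rankCount (map (x ∷_) L) ≗ qPowMul s (rankCount L)
  rankCount-map-∷ L es d with s ≤? d
  ... | yes s≤d with m≤n⇒∃[o]m+o≡n s≤d
  ...   | m , refl = trans (rankCount-map-∷-hit L es m) (sym (qPowMul-hit s (rankCount L) m))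
  rankCount-map-∷ L es d | no s≰d =
    trans (rankCount-map-∷-below L es (≰⇒> s≰d)) (sym (qPowMul-below s (rankCount L) (≰⇒> s≰d)))

qPowSum : List ℕ → (ℕ → ℕ) → ℕ → ℕ
qPowSum [] g d = 0
qPowSum (o ∷ os) g d = qPowMul o g d + qPowSum os g d

qPowSum-map-suc : ∀ os g → qPowSum (map suc os) g ≗ qMul (qPowSum os g)
qPowSum-map-suc [] g zero = refl
qPowSum-map-suc [] g (suc d) = refl
qPowSum-map-suc (o ∷ os) g d =
  trans (cong (qPowMul (suc o) g d +_) (qPowSum-map-suc os g d)) (sym (qMul-+ (qPowMul o g) (qPowSum os g) d))

qPowSum-upTo : ∀ r g → qPowSum (upTo r) g ≗ qIntMul r g
qPowSum-upTo zero g d = refl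
qPowSum-upTo (suc r) g d = cong (g d +_) (begin
  qPowSum (applyUpTo suc r) g d   ≡⟨ cong (λ os → qPowSum os g d) (map-applyUpTo id suc r) ⟨
  qPowSum (map suc (upTo r)) g d  ≡⟨ qPowSum-map-suc (upTo r) g d ⟩
  qMul (qPowSum (upTo r) g) d     ≡⟨ qMul-cong (qPowSum-upTo r g) d ⟩
  qMul (qIntMul r g) d            ∎)
  where open ≡-Reasoning

offset : ℕ × List ℕ → ℕ
offset (x , R) = lessCount x R

offsets-select : ∀ R → Sorted R → map offset (select R) ≡ upTo (length R)
offsets-select [] _ = refl
offsets-select (y ∷ R) (y<R ∷ s) = cong₂ _∷_ (lessCount-none y y<R) (begin
  map offset (map (consRest y) (select R)) ≡⟨ offsets-consRest (select R) (λ m → All.lookup y<R (select-∈ m)) ⟩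
  map suc (map offset (select R))          ≡⟨ cong (map suc) (offsets-select R s) ⟩
  map suc (upTo (length R))                ≡⟨ map-applyUpTo id suc (length R) ⟩
  applyUpTo suc (length R)                 ∎)
  where
  open ≡-Reasoning
  offsets-consRest : ∀ S → (∀ {z R′} → (z , R′) ∈ S → y < z) →
                     map offset (map (consRest y) S) ≡ map suc (map offset S)
  offsets-consRest [] _ = refl
  offsets-consRest ((z , R′) ∷ S) y<S = cong₂ _∷_
    (cong length (filter-accept (_<? z) {xs = R′} (y<S (here refl))))
    (offsets-consRest S (λ m → y<S (there m)))

rankCount-cWordsVia : ∀ S ℓ lam g →
  (∀ {x R′} → (x , R′) ∈ S → All (λ w → lessCount x w ≡ lessCount x R′) (cWordsTail R′ ℓ lam)
                            × rankCount (cWordsTail R′ ℓ lam) ≗ g) →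
  rankCount (cWordsVia S ℓ lam) ≗ qPowSum (map offset S) g
rankCount-cWordsVia [] ℓ lam g h d = refl
rankCount-cWordsVia ((x , R′) ∷ S) ℓ lam g h d = trans
  (rankCount-++ (map (x ∷_) (cWordsTail R′ ℓ lam)) (cWordsVia S ℓ lam) d)
  (cong₂ _+_ (trans (rankCount-map-∷ x (lessCount x R′) (cWordsTail R′ ℓ lam) (proj₁ (h (here refl))) d)
                    (qPowMul-cong (lessCount x R′) (proj₂ (h (here refl))) d))
             (rankCount-cWordsVia S ℓ lam g (λ m → h (there m)) d))

-- The q-integer factors contributed by the free letters, given the number m of letters left.
mutual
  cFactors : ℕ → List ℕ → List ℕ
  cFactors zero lam = []
  cFactors (suc m) [] = []
  cFactors (suc m) (zero ∷ lam) = []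
  cFactors (suc m) (suc ℓ ∷ lam) = cFactorsTail m ℓ lam

  cFactorsTail : ℕ → ℕ → List ℕ → List ℕ
  cFactorsTail m zero lam = cFactors m lam
  cFactorsTail zero (suc ℓ) lam = []
  cFactorsTail (suc m) (suc ℓ) lam = suc m ∷ cFactorsTail m ℓ lam

mutual
  rankCount-cWords : ∀ R lam → Sorted R → All (1 ≤_) lam → sum lam ≡ length R →
                     rankCount (cWords R lam) ≗ qIntProdMul (cFactors (length R) lam) δ₀
  rankCount-cWords [] [] _ _ _ zero = refl
  rankCount-cWords [] [] _ _ _ (suc d) = refl
  rankCount-cWords [] (suc ℓ ∷ lam) _ _ ()
  rankCount-cWords R (zero ∷ lam) _ (() ∷ _) _
  rankCount-cWords (a ∷ R) (suc ℓ ∷ lam) (a<R ∷ s) (_ ∷ ps) e d = trans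
    (rankCount-map-∷ a 0 (cWordsTail R ℓ lam) none-less d)
    (rankCount-cWordsTail R ℓ lam s ps (suc-injective e) d)
    where
    none-less : All (λ w → lessCount a w ≡ 0) (cWordsTail R ℓ lam)
    none-less = All.tabulate (λ w∈ → trans (lessCount-↭ a (cWordsTail-↭ R ℓ lam s w∈)) (lessCount-none a a<R))

  -- [m]_q = Σ_{o < m} q^o arises as the offsets of the m possible next letters.
  rankCount-cWordsTail : ∀ R ℓ lam → Sorted R → All (1 ≤_) lam → ℓ + sum lam ≡ length R →
                         rankCount (cWordsTail R ℓ lam) ≗ qIntProdMul (cFactorsTail (length R) ℓ lam) δ₀
  rankCount-cWordsTail R zero lam s ps e = rankCount-cWords R lam s ps e
  rankCount-cWordsTail (y ∷ R) (suc ℓ) lam s ps e d = begin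
    rankCount (cWordsVia (select (y ∷ R)) ℓ lam) d  ≡⟨ rankCount-cWordsVia (select (y ∷ R)) ℓ lam g each d ⟩
    qPowSum (map offset (select (y ∷ R))) g d      ≡⟨ cong (λ os → qPowSum os g d) (offsets-select (y ∷ R) s) ⟩
    qPowSum (upTo (suc (length R))) g d             ≡⟨ qPowSum-upTo (suc (length R)) g d ⟩
    qIntMul (suc (length R)) g d                    ∎
    where
    open ≡-Reasoning
    g : ℕ → ℕ
    g = qIntProdMul (cFactorsTail (length R) ℓ lam) δ₀
    each : ∀ {x R′} → (x , R′) ∈ select (y ∷ R) →
           All (λ w → lessCount x w ≡ lessCount x R′) (cWordsTail R′ ℓ lam)
           × rankCount (cWordsTail R′ ℓ lam) ≗ g
    each {x} {R′} x∈ =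
      All.tabulate (λ w∈ → lessCount-↭ x (cWordsTail-↭ R′ ℓ lam s′ w∈)) ,
      λ d → trans (rankCount-cWordsTail R′ ℓ lam s′ ps (trans (suc-injective e) (sym length-R′)) d)
                                   (cong (λ m → qIntProdMul (cFactorsTail m ℓ lam) δ₀ d) length-R′)
      where
      s′ : Sorted R′
      s′ = select-sorted s x∈
      length-R′ : length R′ ≡ length R
      length-R′ = suc-injective (↭-length (select-↭ x∈))

mutual
  cFactors-bounded : ∀ m lam → All (λ i → 1 ≤ i × i ≤ m ∸ 1) (cFactors m lam)
  cFactors-bounded zero lam = []
  cFactors-bounded (suc m) [] = []
  cFactors-bounded (suc m) (zero ∷ lam) = []
  cFactors-bounded (suc m) (suc ℓ ∷ lam) = cFactorsTail-bounded m ℓ lam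

  cFactorsTail-bounded : ∀ m ℓ lam → All (λ i → 1 ≤ i × i ≤ m) (cFactorsTail m ℓ lam)
  cFactorsTail-bounded m zero lam =
    All.map (λ (1≤i , i≤m∸1) → 1≤i , ≤-trans i≤m∸1 (m∸n≤m m 1)) (cFactors-bounded m lam)
  cFactorsTail-bounded zero (suc ℓ) lam = []
  cFactorsTail-bounded (suc m) (suc ℓ) lam =
    (s≤s z≤n , ≤-refl) ∷
    All.map (λ (1≤i , i≤m) → 1≤i , m≤n⇒m≤1+n i≤m) (cFactorsTail-bounded m ℓ lam)

mutual
  cFactors-decreasing : ∀ m lam → AllPairs _>_ (cFactors m lam)
  cFactors-decreasing zero lam = []
  cFactors-decreasing (suc m) [] = []
  cFactors-decreasing (suc m) (zero ∷ lam) = []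
  cFactors-decreasing (suc m) (suc ℓ ∷ lam) = cFactorsTail-decreasing m ℓ lam

  cFactorsTail-decreasing : ∀ m ℓ lam → AllPairs _>_ (cFactorsTail m ℓ lam)
  cFactorsTail-decreasing m zero lam = cFactors-decreasing m lam
  cFactorsTail-decreasing zero (suc ℓ) lam = []
  cFactorsTail-decreasing (suc m) (suc ℓ) lam =
    All.map (s≤s ∘ proj₂) (cFactorsTail-bounded m ℓ lam) ∷ cFactorsTail-decreasing m ℓ lam

AllPairs-reverse : ∀ {R : ℕ → ℕ → Set} {xs} → AllPairs R xs → AllPairs (λ x y → R y x) (reverse xs)
AllPairs-reverse [] = []
AllPairs-reverse {xs = x ∷ xs} (Rx ∷ Rxs) = subst (AllPairs _) (sym (unfold-reverse x xs))
  (AllPairs.++⁺ (AllPairs-reverse Rxs) ([] ∷ [])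
    (All.map (_∷ []) (All-resp-↭ (↭-sym (↭-reverse xs)) Rx)))

ascendingFactors : ℕ → List ℕ → List ℕ
ascendingFactors n lam = reverse (filter (2 ≤?_) (cFactors n lam))

ascendingFactors-increasing : ∀ n lam → Linked _<_ (ascendingFactors n lam)
ascendingFactors-increasing n lam =
  AllPairs⇒Linked (AllPairs-reverse (AllPairs.filter⁺ (2 ≤?_) (cFactors-decreasing n lam)))

ascendingFactors-bounded : ∀ n lam → All (λ i → 2 ≤ i × i ≤ n ∸ 1) (ascendingFactors n lam)
ascendingFactors-bounded n lam = All-resp-↭ (↭-sym (↭-reverse _))
  (All.zipWith (λ (2≤i , _ , i≤n∸1) → 2≤i , i≤n∸1)
    (All.all-filter (2 ≤?_) (cFactors n lam) , All.filter⁺ (2 ≤?_) (cFactors-bounded n lam)))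

qIntProdMul-ascendingFactors : ∀ n lam f → qIntProdMul (ascendingFactors n lam) f ≗ qIntProdMul (cFactors n lam) f
qIntProdMul-ascendingFactors n lam f d = trans
  (qIntProdMul-↭ (↭-reverse (filter (2 ≤?_) (cFactors n lam))) f d)
  (qIntProdMul-filter (cFactors n lam) (All.map proj₁ (cFactors-bounded n lam)) f d)

Unique-resp-↭ : ∀ {xs ys : List ℕ} → xs ↭ ys → Unique xs → Unique ys
Unique-resp-↭ p = PermutationSetoid.Unique-resp-↭ (setoid ℕ) (↭⇒↭ₛ p)

[1‥n]-sorted : ∀ n → Sorted [1‥ n ]
[1‥n]-sorted n = AllPairs.map⁺ (AllPairs.applyUpTo⁺₁ id n (λ i<j _ → s≤s i<j))

applyUpTo-⟨⟩ : ∀ h m {x} → x < m → applyUpTo h m ⟨ suc x ⟩ ≡ h x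
applyUpTo-⟨⟩ h (suc m) {zero} _ = refl
applyUpTo-⟨⟩ h (suc m) {suc x} (s≤s x<m) = applyUpTo-⟨⟩ (h ∘ suc) m x<m

map-[1‥n]-⟨⟩ : ∀ g n {u} → u ∈ [1‥ n ] → map g [1‥ n ] ⟨ u ⟩ ≡ g u
map-[1‥n]-⟨⟩ g n u∈ with ∈-map⁻ suc u∈
... | x , x∈ , refl = trans (cong (_⟨ suc x ⟩) map-g-[1‥n]) (applyUpTo-⟨⟩ (g ∘ suc) n (∈-upTo⁻ x∈))
  where
  map-g-[1‥n] : map g [1‥ n ] ≡ applyUpTo (g ∘ suc) n
  map-g-[1‥n] = trans (sym (map-∘ (upTo n))) (map-applyUpTo id (g ∘ suc) n)

chainPairs : ℕ → List ℕ → List (ℕ × ℕ)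
chainPairs x [] = []
chainPairs x (y ∷ ys) = (x , y) ∷ chainPairs y ys

cyclePairs : List Cycle → List (ℕ × ℕ)
cyclePairs [] = []
cyclePairs ((a , as) ∷ cs) = chainPairs a (as ++ [ a ]) ++ cyclePairs cs

map-proj₁-cyclePairs : ∀ cs → map proj₁ (cyclePairs cs) ≡ Ωword cs
map-proj₁-cyclePairs [] = refl
map-proj₁-cyclePairs ((a , as) ∷ cs) = trans (map-++ proj₁ (chainPairs a (as ++ [ a ])) (cyclePairs cs))
  (cong₂ _++_ (sources a as) (map-proj₁-cyclePairs cs))
  where
  sources : ∀ x ys → map proj₁ (chainPairs x (ys ++ [ a ])) ≡ x ∷ ys
  sources x [] = refl
  sources x (y ∷ ys) = cong (x ∷_) (sources y ys)

map-proj₂-chainPairs : ∀ x ys → map proj₂ (chainPairs x ys) ≡ ys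
map-proj₂-chainPairs x [] = refl
map-proj₂-chainPairs x (y ∷ ys) = cong (y ∷_) (map-proj₂-chainPairs y ys)

map-proj₂-cyclePairs : ∀ cs → map proj₂ (cyclePairs cs) ↭ Ωword cs
map-proj₂-cyclePairs [] = ↭-refl
map-proj₂-cyclePairs ((a , as) ∷ cs) rewrite map-++ proj₂ (chainPairs a (as ++ [ a ])) (cyclePairs cs)
                                           | map-proj₂-chainPairs a (as ++ [ a ]) =
  ↭-trans (++⁺ˡ (as ++ [ a ]) (map-proj₂-cyclePairs cs))
    (↭-trans (↭-reflexive (++-assoc as [ a ] (Ωword cs))) (shift a as (Ωword cs)))

lookupPair : List (ℕ × ℕ) → ℕ → ℕ
lookupPair [] u = 0
lookupPair ((a , b) ∷ ps) u with a ≟ u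
... | yes _ = b
... | no _ = lookupPair ps u

lookupPair-∈ : ∀ ps {u v} → Unique (map proj₁ ps) → (u , v) ∈ ps → lookupPair ps u ≡ v
lookupPair-∈ ((a , b) ∷ ps) {u} (_ ∷ _) (here refl) with a ≟ u
... | yes _ = refl
... | no a≢u = ⊥-elim (a≢u refl)
lookupPair-∈ ((a , b) ∷ ps) {u} (a∉ps ∷ u-ps) (there m) with a ≟ u
... | yes refl = ⊥-elim (All.lookup a∉ps (∈-map⁺ proj₁ m) refl)
... | no _ = lookupPair-∈ ps u-ps m

map-lookupPair : ∀ ps qs → (∀ {u v} → (u , v) ∈ qs → lookupPair ps u ≡ v) →
                 map (lookupPair ps) (map proj₁ qs) ≡ map proj₂ qs
map-lookupPair ps [] h = refl
map-lookupPair ps ((u , v) ∷ qs) h = cong₂ _∷_ (h (here refl)) (map-lookupPair ps qs (λ m → h (there m)))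

chain-of-pairs : ∀ π x ys → (∀ {u v} → (u , v) ∈ chainPairs x ys → π ⟨ u ⟩ ≡ v) → Chain π x ys
chain-of-pairs π x [] h = tt
chain-of-pairs π x (y ∷ ys) h = h (here refl) , chain-of-pairs π y ys (λ m → h (there m))

stdCycles-of-pairs : ∀ π cs → (∀ {u v} → (u , v) ∈ cyclePairs cs → π ⟨ u ⟩ ≡ v) →
                     All (λ c → All (proj₁ c ≤_) (proj₂ c)) cs → All (IsStdCycleOf π) cs
stdCycles-of-pairs π [] h [] = []
stdCycles-of-pairs π ((a , as) ∷ cs) h (a≤as ∷ std) =
  (a≤as , chain-of-pairs π a (as ++ [ a ]) (h ∘ ∈-++⁺ˡ)) ∷ stdCycles-of-pairs π cs (h ∘ ∈-++⁺ʳ _) std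

permOfCycles : ∀ n cs → Ωword cs ↭ [1‥ n ] → StdCycles cs →
               Σ (List ℕ) λ π → IsPerm n π × All (IsStdCycleOf π) cs
permOfCycles n cs Ω↭ std = π , π-perm , stdCycles-of-pairs π cs π-pairs (proj₁ std)
  where
  P : List (ℕ × ℕ)
  P = cyclePairs cs
  π : List ℕ
  π = map (lookupPair P) [1‥ n ]
  sources-unique : Unique (map proj₁ P)
  sources-unique = subst Unique (sym (map-proj₁-cyclePairs cs))
    (Unique-resp-↭ (↭-sym Ω↭) (AllPairs.map <⇒≢ ([1‥n]-sorted n)))
  π-pairs : ∀ {u v} → (u , v) ∈ P → π ⟨ u ⟩ ≡ v
  π-pairs {u} m = trans
    (map-[1‥n]-⟨⟩ (lookupPair P) n
      (∈-resp-↭ Ω↭ (subst (u ∈_) (map-proj₁-cyclePairs cs) (∈-map⁺ proj₁ m))))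
    (lookupPair-∈ P sources-unique m)
  π-perm : π ↭ [1‥ n ]
  π-perm = ↭-trans (map⁺ (lookupPair P) (↭-sym Ω↭))
    (subst (λ l → map (lookupPair P) l ↭ [1‥ n ]) (map-proj₁-cyclePairs cs)
      (subst (_↭ [1‥ n ]) (sym (map-lookupPair P P (lookupPair-∈ P sources-unique)))
        (↭-trans (map-proj₂-cyclePairs cs) Ω↭)))

∈-cWords⇔InC : ∀ n lam w → (w ∈ cWords [1‥ n ] lam) ⇔ InC n lam w
∈-cWords⇔InC n lam w = mk⇔ sound complete
  where
  sound : w ∈ cWords [1‥ n ] lam → InC n lam w
  sound w∈ with cWords-sound [1‥ n ] lam ([1‥n]-sorted n) w∈
  ... | record { cycles = cs ; Ωword≡ = Ωword≡ ; compType≡ = compType≡ ; Ωword↭ = Ωword↭ ; std = std }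
    with permOfCycles n cs Ωword↭ std
  ...   | π , π-perm , std-π = π , π-perm , cs , (Ωword↭ , std-π , proj₂ std) , compType≡ , Ωword≡
  complete : InC n lam w → w ∈ cWords [1‥ n ] lam
  complete (π , _ , cs , (Ωword↭ , std-π , increasing) , refl , refl) =
    cWords-complete [1‥ n ] cs ([1‥n]-sorted n) (All.map proj₁ std-π , increasing) Ωword↭

rankCount-cWords-[1‥n] : ∀ n lam → IsComposition n lam →
                         rankCount (cWords [1‥ n ] lam) ≗ qIntProdMul (cFactors n lam) δ₀
rankCount-cWords-[1‥n] n lam (positive , sum≡n) d =
  subst (λ m → rankCount (cWords [1‥ n ] lam) d ≡ qIntProdMul (cFactors m lam) δ₀ d) length-[1‥n]
    (rankCount-cWords [1‥ n ] lam ([1‥n]-sorted n) positive (trans sum≡n (sym length-[1‥n])) d)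
  where
  length-[1‥n] : length [1‥ n ] ≡ n
  length-[1‥n] = trans (length-map suc (upTo n)) (length-upTo n)

theoremB : (n : ℕ) (lam : List ℕ) → IsComposition n lam →
    Σ (List (List ℕ)) λ L →
      Unique L × (∀ w → (w ∈ L) ⇔ InC n lam w) ×
      RankSymmetric L × Unimodal L ×
      Σ (List ℕ) λ is →
        Linked _<_ is × All (λ i → 2 ≤ i × i ≤ n ∸ 1) is ×
        (∀ d → rankCount L d ≡ coeff (qIntProd is) d)
theoremB n lam composition =
  L , cWords-unique [1‥ n ] lam ([1‥n]-sorted n) , ∈-cWords⇔InC n lam ,
  rankSymmetric L su f0≡1 counts , unimodal L su f0≡1 counts ,
  is , ascendingFactors-increasing n lam , bounded ,
  λ d → trans (counts d) (sym (coeff-qIntProd is d))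
  where
  L : List (List ℕ)
  L = cWords [1‥ n ] lam
  is : List ℕ
  is = ascendingFactors n lam
  bounded : All (λ i → 2 ≤ i × i ≤ n ∸ 1) is
  bounded = ascendingFactors-bounded n lam
  counts : rankCount L ≗ qIntProdMul is δ₀
  counts d = trans (rankCount-cWords-[1‥n] n lam composition d)
                   (sym (qIntProdMul-ascendingFactors n lam δ₀ d))
  positive : All (1 ≤_) is
  positive = All.map (≤-trans (s≤s z≤n) ∘ proj₁) bounded
  su : SymmetricUnimodal (degree is) (qIntProdMul is δ₀)
  su = symmetricUnimodal-qIntProdMul is positive
  f0≡1 : qIntProdMul is δ₀ 0 ≡ 1
  f0≡1 = qIntProdMul-δ₀-0 is positive
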